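{- Every subresiduated Nelson algebra is a hemi-Nelson algebra.
   Context: A Kleene algebra is a bounded distributive lattice $\langle T,\wedge,\vee,0,1\rangle$ with a unary operation $\sim$ such that $\sim\sim x=x$, $\sim(x\wedge y)=\sim x\vee\sim y$ and $(x\wedge\sim x)\wedge(y\vee\sim y)=x\wedge\sim x$. A subresiduated Nelson algebra is an algebra $\langle T,\wedge,\vee,\rightarrow,\sim,0,1\rangle$ of type $(2,2,2,1,0,0)$ such that $\langle T,\wedge,\vee,\sim,0,1\rangle$ is a Kleene algebra and for all $x,y,z\in T$: (1) $(x\vee y)\rightarrow z=(x\rightarrow z)\wedge(y\rightarrow z)$; (2) $z\rightarrow(x\wedge y)=(z\rightarrow x)\wedge(z\rightarrow y)$; (3) $((x\rightarrow y)\wedge(y\rightarrow z))\rightarrow(x\rightarrow z)=1$; (4) $x\rightarrow x=1$; (5) $x\wedge(x\rightarrow y)\le x\wedge(\sim x\vee y)$; (6) $x\rightarrow y\le z\rightarrow(x\rightarrow y)$; (7) $\sim(x\rightarrow y)\rightarrow(x\wedge\sim y)=1$; (8) $(x\wedge\sim y)\rightarrow\sim(x\rightarrow y)=1$. A hemi-Nelson algebra is an algebra $\langle T,\wedge,\vee,\rightarrow,\sim,0,1\rangle$ of type $(2,2,2,1,0,0)$ such that $\langle T,\wedge,\vee,\sim,0,1\rangle$ is a Kleene algebra and for all $x,y,z\in T$: (hN1) $x\rightarrow x=1$; (hN2) $x\wedge(x\rightarrow y)\le x\wedge(\sim x\vee y)$; (hN3) $\sim(x\rightarrow y)\rightarrow(x\wedge\sim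 y)=1$; (hN4) $(x\wedge\sim y)\rightarrow\sim(x\rightarrow y)=1$; (hN5) $(x\wedge y\wedge(x\rightarrow y))\rightarrow(x\wedge(x\rightarrow y))=1$; (hN6) $(x\wedge(x\rightarrow y))\rightarrow(x\wedge y\wedge(x\rightarrow y))=1$; (hN7) if $x\rightarrow y=1$, $y\rightarrow x=1$, $y\rightarrow z=1$ and $z\rightarrow y=1$ then $x\rightarrow z=1$ and $z\rightarrow x=1$; (hN8) if $x\rightarrow y=1$ and $y\rightarrow x=1$ then $(x\wedge z)\rightarrow(y\wedge z)=1$; (hN9) if $x\rightarrow y=1$ and $y\rightarrow x=1$ then $(x\vee z)\rightarrow(y\vee z)=1$; (hN10) if $x\rightarrow y=1$ and $y\rightarrow x=1$ then $(x\rightarrow z)\rightarrow(y\rightarrow z)=1$ and $(z\rightarrow x)\rightarrow(z\rightarrow y)=1$. -}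

module Defs where

open import Level using (Level)
open import Relation.Binary.PropositionalEquality using (_≡_)
open import Data.Product using (_×_)
open import Algebra.Core using (Op₁; Op₂)
open import Algebra.Lattice.Structures using (IsDistributiveLattice)

record RawNAlgebra {a : Level} (T : Set a) : Set a where
  field
    _∧_ _∨_ _⇒_ : Op₂ T
    ∼_          : Op₁ T
    ⊥ ⊤         : T
  infixr 5 _⇒_
  infixr 6 _∨_
  infixr 7 _∧_
  infix 8 ∼_

  _≤_ : T → T → Set a
  x ≤ y = (x ∧ y) ≡ x

record IsKleene {a : Level} {T : Set a} (A : RawNAlgebra T) : Set a where
  open RawNAlgebra A
  field
    isDistributiveLattice : IsDistributiveLattice _≡_ _∨_ _∧_
    ⊥-least  : ∀ x → (⊥ ∧ x) ≡ ⊥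
    ⊤-great  : ∀ x → (x ∧ ⊤) ≡ x
    ∼-invol  : ∀ x → ∼ ∼ x ≡ x
    ∼-deMorgan : ∀ x y → ∼ (x ∧ y) ≡ (∼ x ∨ ∼ y)
    kleene   : ∀ x y → ((x ∧ ∼ x) ∧ (y ∨ ∼ y)) ≡ (x ∧ ∼ x)

record IsSubresiduatedNelson {a : Level} {T : Set a} (A : RawNAlgebra T) : Set a where
  open RawNAlgebra A
  field
    isKleene : IsKleene A
    sn1 : ∀ x y z → ((x ∨ y) ⇒ z) ≡ ((x ⇒ z) ∧ (y ⇒ z))
    sn2 : ∀ x y z → (z ⇒ (x ∧ y)) ≡ ((z ⇒ x) ∧ (z ⇒ y))
    sn3 : ∀ x y z → (((x ⇒ y) ∧ (y ⇒ z)) ⇒ (x ⇒ z)) ≡ ⊤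
    sn4 : ∀ x → (x ⇒ x) ≡ ⊤
    sn5 : ∀ x y → (x ∧ (x ⇒ y)) ≤ (x ∧ (∼ x ∨ y))
    sn6 : ∀ x y z → (x ⇒ y) ≤ (z ⇒ (x ⇒ y))
    sn7 : ∀ x y → (∼ (x ⇒ y) ⇒ (x ∧ ∼ y)) ≡ ⊤
    sn8 : ∀ x y → ((x ∧ ∼ y) ⇒ ∼ (x ⇒ y)) ≡ ⊤

record IsHemiNelson {a : Level} {T : Set a} (A : RawNAlgebra T) : Set a where
  open RawNAlgebra A
  field
    isKleene : IsKleene A
    hN1 : ∀ x → (x ⇒ x) ≡ ⊤
    hN2 : ∀ x y → (x ∧ (x ⇒ y)) ≤ (x ∧ (∼ x ∨ y))
    hN3 : ∀ x y → (∼ (x ⇒ y) ⇒ (x ∧ ∼ y)) ≡ ⊤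
    hN4 : ∀ x y → ((x ∧ ∼ y) ⇒ ∼ (x ⇒ y)) ≡ ⊤
    hN5 : ∀ x y → ((x ∧ y ∧ (x ⇒ y)) ⇒ (x ∧ (x ⇒ y))) ≡ ⊤
    hN6 : ∀ x y → ((x ∧ (x ⇒ y)) ⇒ (x ∧ y ∧ (x ⇒ y))) ≡ ⊤
    hN7 : ∀ x y z → (x ⇒ y) ≡ ⊤ → (y ⇒ x) ≡ ⊤ → (y ⇒ z) ≡ ⊤ → (z ⇒ y) ≡ ⊤
          → ((x ⇒ z) ≡ ⊤) × ((z ⇒ x) ≡ ⊤)
    hN8 : ∀ x y z → (x ⇒ y) ≡ ⊤ → (y ⇒ x) ≡ ⊤ → ((x ∧ z) ⇒ (y ∧ z)) ≡ ⊤
    hN9 : ∀ x y z → (x ⇒ y) ≡ ⊤ → (y ⇒ x) ≡ ⊤ → ((x ∨ z) ⇒ (y ∨ z)) ≡ ⊤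
    hN10 : ∀ x y z → (x ⇒ y) ≡ ⊤ → (y ⇒ x) ≡ ⊤
          → (((x ⇒ z) ⇒ (y ⇒ z)) ≡ ⊤) × (((z ⇒ x) ⇒ (z ⇒ y)) ≡ ⊤)

{-# OPTIONS --safe #-}
module Submission where

-- Write x ⊢ y for x ⇒ y ≡ ⊤. Axioms (2) and (4) make ⊢ contain the lattice order, and (5) together
-- with ∼ ⊤ ≡ ⊥ gives detachment (⊤ ⊢ y implies y ≡ ⊤), so the internal transitivity law (3) makes ⊢
-- transitive. Axioms (1)–(3) then make ∧, ∨ and ⇒ compatible with ⊢, and (5) with (8) yields modus
-- ponens x ∧ (x ⇒ y) ⊢ y; every hemi-Nelson axiom is an instance of these facts.

open import Defs
open import Level using (Level)
open import Data.Product using (_,_)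
open import Relation.Binary.PropositionalEquality
  using (_≡_; sym; trans; cong; cong₂; subst; subst₂; module ≡-Reasoning)
open import Algebra.Lattice.Bundles using (Lattice)
open import Algebra.Lattice.Structures using (IsDistributiveLattice)
import Algebra.Lattice.Properties.Lattice as LatticeProperties
import Relation.Binary.Lattice as OrderTheoretic

module KleeneProperties {a : Level} {T : Set a} {A : RawNAlgebra T} (K : IsKleene A) where
  open RawNAlgebra A hiding (_≤_)
  open IsKleene K
  open IsDistributiveLattice isDistributiveLattice public using (∧-comm; ∧-distribˡ-∨)
  open ≡-Reasoning

  lattice : Lattice a a
  lattice = record { isLattice = IsDistributiveLattice.isLattice isDistributiveLattice }

  open LatticeProperties lattice public using (∧-idem)

  -- The standard library's natural order x ≤ y is x ≡ x ∧ y, the mirror image of RawNAlgebra's _≤_.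
  open OrderTheoretic.Lattice (LatticeProperties.∨-∧-orderTheoreticLattice lattice) public
    using (_≤_; antisym; x≤x∨y; y≤x∨y; ∨-least; x∧y≤x; x∧y≤y; ∧-greatest)
    renaming (refl to ≤-refl; trans to ≤-trans)

  x≤⊤ : ∀ x → x ≤ ⊤
  x≤⊤ x = sym (⊤-great x)

  ⊥≤x : ∀ x → ⊥ ≤ x
  ⊥≤x x = sym (⊥-least x)

  ⊤∧x≡x : ∀ x → ⊤ ∧ x ≡ x
  ⊤∧x≡x x = trans (∧-comm ⊤ x) (⊤-great x)

  ⊥∨x≡x : ∀ x → ⊥ ∨ x ≡ x
  ⊥∨x≡x x = antisym (∨-least (⊥≤x x) ≤-refl) (y≤x∨y ⊥ x)

  ∼⊤≡⊥ : ∼ ⊤ ≡ ⊥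
  ∼⊤≡⊥ = sym (begin
    ⊥               ≡⟨ sym (∼-invol ⊥) ⟩
    ∼ ∼ ⊥           ≡⟨ cong ∼_ (sym (⊤-great (∼ ⊥))) ⟩
    ∼ (∼ ⊥ ∧ ⊤)     ≡⟨ ∼-deMorgan (∼ ⊥) ⊤ ⟩
    ∼ ∼ ⊥ ∨ ∼ ⊤     ≡⟨ cong (_∨ ∼ ⊤) (∼-invol ⊥) ⟩
    ⊥ ∨ ∼ ⊤         ≡⟨ ⊥∨x≡x (∼ ⊤) ⟩
    ∼ ⊤             ∎)

module SubresiduatedNelsonProperties
  {a : Level} {T : Set a} {A : RawNAlgebra T} (S : IsSubresiduatedNelson A) where
  open RawNAlgebra A hiding (_≤_)
  open IsSubresiduatedNelson S
  open IsKleene isKleene using (⊤-great)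
  open KleeneProperties isKleene
  open ≡-Reasoning

  infix 4 _⊢_
  _⊢_ : T → T → Set a
  x ⊢ y = x ⇒ y ≡ ⊤

  ≤⇒⊢ : ∀ {x y} → x ≤ y → x ⊢ y
  ≤⇒⊢ {x} {y} x≡x∧y = begin
    x ⇒ y              ≡⟨ sym (⊤∧x≡x (x ⇒ y)) ⟩
    ⊤ ∧ (x ⇒ y)        ≡⟨ cong (_∧ (x ⇒ y)) (sym (sn4 x)) ⟩
    (x ⇒ x) ∧ (x ⇒ y)  ≡⟨ sym (sn2 x y x) ⟩
    x ⇒ x ∧ y          ≡⟨ cong (x ⇒_) (sym x≡x∧y) ⟩
    x ⇒ x              ≡⟨ sn4 x ⟩
    ⊤                  ∎

  ∧-greatest-⊢ : ∀ {x y z} → z ⊢ x → z ⊢ y → z ⊢ x ∧ y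
  ∧-greatest-⊢ {x} {y} {z} z⊢x z⊢y = begin
    z ⇒ x ∧ y          ≡⟨ sn2 x y z ⟩
    (z ⇒ x) ∧ (z ⇒ y)  ≡⟨ cong₂ _∧_ z⊢x z⊢y ⟩
    ⊤ ∧ ⊤              ≡⟨ ∧-idem ⊤ ⟩
    ⊤                  ∎

  ∨-least-⊢ : ∀ {x y z} → x ⊢ z → y ⊢ z → x ∨ y ⊢ z
  ∨-least-⊢ {x} {y} {z} x⊢z y⊢z = begin
    x ∨ y ⇒ z          ≡⟨ sn1 x y z ⟩
    (x ⇒ z) ∧ (y ⇒ z)  ≡⟨ cong₂ _∧_ x⊢z y⊢z ⟩
    ⊤ ∧ ⊤              ≡⟨ ∧-idem ⊤ ⟩
    ⊤                  ∎

  ∧⇒≤∼∨ : ∀ x y → x ∧ (x ⇒ y) ≤ ∼ x ∨ y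
  ∧⇒≤∼∨ x y = ≤-trans (sym (sn5 x y)) (x∧y≤y x (∼ x ∨ y))

  ⊤⊢⇒≡⊤ : ∀ {y} → ⊤ ⊢ y → y ≡ ⊤
  ⊤⊢⇒≡⊤ {y} ⊤⊢y = antisym (x≤⊤ y) (subst₂ _≤_ ⊤∧[⊤⇒y]≡⊤ ∼⊤∨y≡y (∧⇒≤∼∨ ⊤ y))
    where
    ⊤∧[⊤⇒y]≡⊤ : ⊤ ∧ (⊤ ⇒ y) ≡ ⊤
    ⊤∧[⊤⇒y]≡⊤ = trans (cong (⊤ ∧_) ⊤⊢y) (∧-idem ⊤)
    ∼⊤∨y≡y : ∼ ⊤ ∨ y ≡ y
    ∼⊤∨y≡y = trans (cong (_∨ y) ∼⊤≡⊥) (⊥∨x≡x y)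

  ⊢-trans : ∀ {x y z} → x ⊢ y → y ⊢ z → x ⊢ z
  ⊢-trans {x} {y} {z} x⊢y y⊢z = ⊤⊢⇒≡⊤ (begin
    ⊤ ⇒ x ⇒ z                  ≡⟨ cong (_⇒ x ⇒ z) (sym (∧-idem ⊤)) ⟩
    ⊤ ∧ ⊤ ⇒ x ⇒ z              ≡⟨ cong₂ (λ u v → u ∧ v ⇒ x ⇒ z) (sym x⊢y) (sym y⊢z) ⟩
    (x ⇒ y) ∧ (y ⇒ z) ⇒ x ⇒ z  ≡⟨ sn3 x y z ⟩
    ⊤                          ∎)

  ∧-monoˡ-⊢ : ∀ {x y} z → x ⊢ y → x ∧ z ⊢ y ∧ z
  ∧-monoˡ-⊢ {x} z x⊢y = ∧-greatest-⊢ (⊢-trans (≤⇒⊢ (x∧y≤x x z)) x⊢y) (≤⇒⊢ (x∧y≤y x z))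

  ∨-monoˡ-⊢ : ∀ {x y} z → x ⊢ y → x ∨ z ⊢ y ∨ z
  ∨-monoˡ-⊢ {y = y} z x⊢y = ∨-least-⊢ (⊢-trans x⊢y (≤⇒⊢ (x≤x∨y y z))) (≤⇒⊢ (y≤x∨y y z))

  ⇒-antimonoˡ-⊢ : ∀ {x y} z → y ⊢ x → x ⇒ z ⊢ y ⇒ z
  ⇒-antimonoˡ-⊢ {x} {y} z y⊢x =
    subst (_⊢ y ⇒ z) (trans (cong (_∧ (x ⇒ z)) y⊢x) (⊤∧x≡x (x ⇒ z))) (sn3 y x z)

  ⇒-monoʳ-⊢ : ∀ {x y} z → x ⊢ y → z ⇒ x ⊢ z ⇒ y
  ⇒-monoʳ-⊢ {x} {y} z x⊢y =
    subst (_⊢ z ⇒ y) (trans (cong ((z ⇒ x) ∧_) x⊢y) (⊤-great (z ⇒ x))) (sn3 z x y)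

  x∧∼x⊢y : ∀ x y → x ∧ ∼ x ⊢ y
  x∧∼x⊢y x y = ⊢-trans x∧∼x⊢⊥ (≤⇒⊢ (⊥≤x y))
    where
    x∧∼x⊢⊥ : x ∧ ∼ x ⊢ ⊥
    x∧∼x⊢⊥ = subst (x ∧ ∼ x ⊢_) (trans (cong ∼_ (sn4 x)) ∼⊤≡⊥) (sn8 x x)

  modus-ponens : ∀ x y → x ∧ (x ⇒ y) ⊢ y
  modus-ponens x y = ⊢-trans (≤⇒⊢ (sym (sn5 x y))) x∧[∼x∨y]⊢y
    where
    x∧[∼x∨y]⊢y : x ∧ (∼ x ∨ y) ⊢ y
    x∧[∼x∨y]⊢y = subst (_⊢ y) (sym (∧-distribˡ-∨ x (∼ x) y))
                   (∨-least-⊢ (x∧∼x⊢y x y) (≤⇒⊢ (x∧y≤y x y)))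

proposition49 : {a : Level} {T : Set a} (A : RawNAlgebra T) → IsSubresiduatedNelson A → IsHemiNelson A
proposition49 A S = record
  { isKleene = isKleene
  ; hN1 = sn4
  ; hN2 = sn5
  ; hN3 = sn7
  ; hN4 = sn8
  ; hN5 = λ x y → ≤⇒⊢ (∧-greatest (x∧y≤x x _) (≤-trans (x∧y≤y x _) (x∧y≤y y _)))
  ; hN6 = λ x y →
      ∧-greatest-⊢ (≤⇒⊢ (x∧y≤x x _)) (∧-greatest-⊢ (modus-ponens x y) (≤⇒⊢ (x∧y≤y x _)))
  ; hN7 = λ _ _ _ x⊢y y⊢x y⊢z z⊢y → ⊢-trans x⊢y y⊢z , ⊢-trans z⊢y y⊢x
  ; hN8 = λ _ _ z x⊢y _ → ∧-monoˡ-⊢ z x⊢y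
  ; hN9 = λ _ _ z x⊢y _ → ∨-monoˡ-⊢ z x⊢y
  ; hN10 = λ _ _ z x⊢y y⊢x → ⇒-antimonoˡ-⊢ z y⊢x , ⇒-monoʳ-⊢ z x⊢y
  }
  where
  open IsSubresiduatedNelson S
  open KleeneProperties isKleene
  open SubresiduatedNelsonProperties S
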